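{- Let $n\ge1$. The map $\psi:\operatorname{Vert}(C_n)\to\mathbb Z^n/(2n+1)\mathbb Z^n$ given by $(\pi,u)\mapsto u\cdot\lambda+(2n+1)\mathbb Z^n$, where $\lambda=(\lambda_1,\dots,\lambda_n)$ with $\lambda_i$ the number of East steps of $\pi$ preceding its $i$-th North step, is a bijection.
   Context: $\mathcal L_{n,n}$: words in $\{N,E\}$ with $n$ of each letter. A rise of $\pi$ is an index $i$ such that the $i$-th North step is immediately followed by a North step. $\mathfrak S_n^C$: the group of signed permutations, i.e. bijections $u$ of $\{\pm1,\dots,\pm n\}$ with $u(-i)=-u(i)$, acting on $\mathbb Z^n$ by $u\cdot e_i=e_{u(i)}$ with $e_{ -i}=-e_i$ (this action descends to $\mathbb Z^n/(2n+1)\mathbb Z^n$). $\operatorname{Vert}(C_n)$ is the set of pairs $(\pi,u)$ with $\pi\in\mathcal L_{n,n}$ and $u\in\mathfrak S_n^C$ such that $u(i)<u(i+1)$ for each rise $i$ of $\pi$, and $u(1)>0$ if $\pi$ begins with a North step. -}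

module Defs where

open import Data.Nat using (ℕ; zero; suc; _≤_)
open import Data.Integer as ℤ using (ℤ; +_; -_; ∣_∣; _+_; _*_; _<_)
open import Data.Integer.Divisibility using (_∣_)
open import Data.Fin using (Fin; toℕ; zero; suc)
open import Data.List using (List; []; _∷_; length; filter)
open import Data.Bool using (Bool; true; false; if_then_else_)
open import Data.Product using (Σ; _×_; _,_; ∃)
open import Relation.Binary.PropositionalEquality using (_≡_)
open import Relation.Nullary.Decidable using (⌊_⌋)

data Step : Set where
  N E : Step

isN : Step → Bool
isN N = true
isN E = false

isE : Step → Bool
isE N = false
isE E = true

countN : List Step → ℕ
countN [] = 0
countN (N ∷ p) = suc (countN p)
countN (E ∷ p) = countN p

countE : List Step → ℕ
countE [] = 0
countE (N ∷ p) = countE p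
countE (E ∷ p) = suc (countE p)

InL : ℕ → List Step → Set
InL n π = (countN π ≡ n) × (countE π ≡ n)

-- number of East steps preceding the (k+1)-th North step (k is 0-based)
eastBefore : List Step → ℕ → ℕ
eastBefore [] k = 0
eastBefore (E ∷ p) k = suc (eastBefore p k)
eastBefore (N ∷ p) zero = 0
eastBefore (N ∷ p) (suc k) = eastBefore p k

-- riseAt π k = true iff the (k+1)-th North step (0-based k) is immediately
-- followed by a North step, i.e. k+1 is a rise of π in the paper's 1-based indexing
riseAt : List Step → ℕ → Bool
riseAt [] k = false
riseAt (E ∷ p) k = riseAt p k
riseAt (N ∷ []) zero = false
riseAt (N ∷ N ∷ p) zero = true
riseAt (N ∷ E ∷ p) zero = false
riseAt (N ∷ p) (suc k) = riseAt p k

startsWithN : List Step → Bool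
startsWithN (N ∷ p) = true
startsWithN _ = false

-- A signed permutation u of {±1,…,±n} with u(-i) = -u(i) is determined by
-- its values u(1),…,u(n) (index i : Fin n stands for i+1); these are nonzero
-- integers of absolute value ≤ n with pairwise distinct absolute values.
IsSignedPerm : (n : ℕ) → (Fin n → ℤ) → Set
IsSignedPerm n u =
  (∀ i → (1 ≤ ∣ u i ∣) × (∣ u i ∣ ≤ n)) ×
  (∀ i j → ∣ u i ∣ ≡ ∣ u j ∣ → i ≡ j)

-- elements of ℤ^n are functions Fin n → ℤ (coordinate j stands for j+1)
-- e_k for k ∈ {±1,…,±n}, with e_{-i} = - e_i (and e_k = 0 otherwise)
basis : (n : ℕ) → ℤ → Fin n → ℤ
basis n k j =
  if ⌊ k ℤ.≟ + suc (toℕ j) ⌋ then + 1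
  else if ⌊ k ℤ.≟ - + suc (toℕ j) ⌋ then - + 1
  else + 0

sumVec : (m n : ℕ) → (Fin m → Fin n → ℤ) → Fin n → ℤ
sumVec zero n f j = + 0
sumVec (suc m) n f j = f zero j + sumVec m n (λ i → f (suc i)) j

act : (n : ℕ) → (Fin n → ℤ) → (Fin n → ℤ) → Fin n → ℤ
act n u v = sumVec n n (λ i j → v i * basis n (u i) j)

lambdaVec : (n : ℕ) → List Step → Fin n → ℤ
lambdaVec n π i = + eastBefore π (toℕ i)

IsVert : (n : ℕ) → List Step → (Fin n → ℤ) → Set
IsVert n π u =
  InL n π × IsSignedPerm n u ×
  (∀ (i j : Fin n) → toℕ j ≡ suc (toℕ i) → riseAt π (toℕ i) ≡ true → u i < u j) ×
  (startsWithN π ≡ true → ∀ (i : Fin n) → toℕ i ≡ 0 → + 0 < u i)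

psi : (n : ℕ) → List Step → (Fin n → ℤ) → Fin n → ℤ
psi n π u = act n u (lambdaVec n π)

-- congruence modulo (2n+1) coordinatewise, i.e. equality in ℤ^n/(2n+1)ℤ^n
_≡[mod_]_ : {n : ℕ} → (Fin n → ℤ) → ℕ → (Fin n → ℤ) → Set
_≡[mod_]_ {n} v m w = ∀ j → (+ m) ∣ (v j ℤ.- w j)

-- In ψ(π, u) the coordinate |u(i)| carries ±λᵢ, signed like u(i), and every other contribution
-- vanishes; as 0 ≤ λᵢ ≤ n, all entries lie in [-n, n], a system of representatives modulo 2n+1.
-- Read the entry x of a balanced vector in coordinate j as the pair (|x|, ±(j+1)), signed like x
-- (with + when x = 0). The conditions defining Vert(C_n) say exactly that the pairs (λᵢ, u(i))
-- strictly increase lexicographically in i: λ is weakly increasing, equal consecutive values mean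
-- a rise and hence u(i) < u(i+1), and λᵢ = 0 forces u(i) > 0, which restores the sign lost at an
-- entry 0. So (π, u) is recovered by sorting the pairs of ψ(π, u), and sorting the pairs of an
-- arbitrary balanced vector produces a vertex mapping to it.
module Submission where

open import Defs
open import Data.Nat as ℕ using (ℕ; zero; suc; _≤_; z≤n; s≤s)
import Data.Nat.Properties as ℕP
import Data.Nat.Divisibility as ℕD
open import Data.Integer as ℤ using (ℤ; +_; -[1+_]; -_; ∣_∣; _*_; _-_; sign; _◃_)
import Data.Integer.Properties as ℤP
open import Data.Integer.Divisibility using (_∣_)
open import Data.Integer.DivMod using (_%ℕ_; _/ℕ_; n%ℕd<d; a≡a%ℕn+[a/ℕn]*n)
open import Data.Integer.Tactic.RingSolver using (solve-∀)
import Data.Sign as Sign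
open import Data.Fin as Fin using (Fin; zero; suc; toℕ; fromℕ<; inject₁; punchOut)
import Data.Fin.Properties as FinP
open import Data.Fin.Subset using (Subset; ⊤; _∈_; _∉_; _⊂_)
  renaming (∣_∣ to size)
open import Data.Fin.Subset.Properties using (∈⊤; ⊆⊤; ∣⊤∣≡n; p⊂q⇒∣p∣<∣q∣)
open import Data.Vec using (tabulate)
open import Data.Vec.Properties using (lookup∘tabulate; []=⇒lookup; lookup⇒[]=)
open import Data.Bool using (true)
open import Data.List using (List; []; _∷_)
open import Data.Product using (Σ; ∃; _×_; _,_; proj₁; proj₂)
open import Data.Product.Relation.Binary.Lex.Strict using (×-strictTotalOrder)
open import Data.Sum using (_⊎_; inj₁; inj₂)
open import Function using (_∘_)
open import Function.Definitions using (Injective)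
open import Relation.Binary.Bundles using (StrictTotalOrder)
open import Relation.Binary.Definitions using (tri<; tri≈; tri>)
open import Relation.Binary.PropositionalEquality
open import Relation.Nullary using (Dec; yes; no; does; contradiction)
open import Relation.Nullary.Decidable using (dec-true)

-- Balanced residues modulo 2n+1

balanced-residue-unique : ∀ n {a b} → ∣ a ∣ ≤ n → ∣ b ∣ ≤ n →
                          + suc (n ℕ.+ n) ∣ (a - b) → a ≡ b
balanced-residue-unique n {a} {b} ∣a∣≤n ∣b∣≤n M∣a-b with ∣ a - b ∣ in eq
... | zero  = ℤP.i-j≡0⇒i≡j a b (ℤP.∣i∣≡0⇒i≡0 eq)
... | suc k = contradiction (ℕD.∣⇒≤ M∣a-b) (ℕP.<⇒≱ (s≤s ∣a-b∣≤n+n))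
  where
  ∣a-b∣≤n+n : suc k ≤ n ℕ.+ n
  ∣a-b∣≤n+n = subst (_≤ n ℕ.+ n) eq
    (ℕP.≤-trans (ℤP.∣i-j∣≤∣i∣+∣j∣ a b) (ℕP.+-mono-≤ ∣a∣≤n ∣b∣≤n))

∣-multiple : ∀ m k {x} → x ≡ k * + m → + m ∣ x
∣-multiple m k eq = ℕD.divides ∣ k ∣ (trans (cong ∣_∣ eq) (ℤP.abs-* k (+ m)))

balanced-residue : ∀ n x → Σ ℤ λ r → ∣ r ∣ ≤ n × + suc (n ℕ.+ n) ∣ (r - x)
balanced-residue n x = choose (a ℕ.≤? n)
  where
  M a : ℕ
  M = suc (n ℕ.+ n)
  a = x %ℕ M
  q : ℤ
  q = x /ℕ M

  shift₀ : ∀ a q m → a - (a ℤ.+ q * m) ≡ - q * m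
  shift₀ = solve-∀
  shift₁ : ∀ a q m → (a - m) - (a ℤ.+ q * m) ≡ - (q ℤ.+ ℤ.1ℤ) * m
  shift₁ = solve-∀

  ∣a-M∣≤n : n ℕ.< a → ∣ + a - + M ∣ ≤ n
  ∣a-M∣≤n n<a = begin
    ∣ + a - + M ∣ ≡⟨ cong ∣_∣ (ℤP.m-n≡m⊖n a M) ⟩
    ∣ a ℤ.⊖ M ∣   ≡⟨ ℤP.∣⊖∣-≤ (ℕP.<⇒≤ (n%ℕd<d x M)) ⟩
    M ℕ.∸ a       ≤⟨ ℕP.∸-monoʳ-≤ M n<a ⟩
    M ℕ.∸ suc n   ≡⟨ ℕP.m+n∸m≡n n n ⟩
    n             ∎
    where open ℕP.≤-Reasoning

  choose : Dec (a ≤ n) → Σ ℤ λ r → ∣ r ∣ ≤ n × + M ∣ (r - x)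
  choose (yes a≤n) = + a , a≤n , ∣-multiple M (- q)
    (trans (cong (λ t → + a - t) (a≡a%ℕn+[a/ℕn]*n x M)) (shift₀ (+ a) q (+ M)))
  choose (no a≰n)  = + a - + M , ∣a-M∣≤n (ℕP.≰⇒> a≰n) , ∣-multiple M (- (q ℤ.+ ℤ.1ℤ))
    (trans (cong (λ t → (+ a - + M) - t) (a≡a%ℕn+[a/ℕn]*n x M)) (shift₁ (+ a) q (+ M)))

-- Sorting a finite family by an injective key

Increasing : ∀ {n} → (Fin n → ℕ) → Set
Increasing g = ∀ i j → toℕ j ≡ suc (toℕ i) → g i ℕ.< g j

mutual
  increasing-bounded⇒≡toℕ : ∀ {n} (g : Fin n → ℕ) → Increasing g → (∀ i → g i ℕ.< n) →
                           ∀ i → g i ≡ toℕ i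
  increasing-bounded⇒≡toℕ {suc zero}    g inc bnd zero    = ℕP.n<1⇒n≡0 (bnd zero)
  increasing-bounded⇒≡toℕ {suc (suc n)} g inc bnd zero    = ℕP.n<1⇒n≡0
    (subst (g zero ℕ.<_) (increasing-bounded⇒≡toℕ-suc g inc bnd zero) (inc zero (suc zero) refl))
  increasing-bounded⇒≡toℕ {suc n}       g inc bnd (suc i) = increasing-bounded⇒≡toℕ-suc g inc bnd i

  increasing-bounded⇒≡toℕ-suc : ∀ {n} (g : Fin (suc n) → ℕ) → Increasing g → (∀ i → g i ℕ.< suc n) →
                               ∀ i → g (suc i) ≡ suc (toℕ i)
  increasing-bounded⇒≡toℕ-suc {n} g inc bnd i = begin
    g (suc i)      ≡⟨ g-suc i ⟩
    suc (g′ i)     ≡⟨ cong suc (increasing-bounded⇒≡toℕ g′ inc′ bnd′ i) ⟩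
    suc (toℕ i)    ∎
    where
    open ≡-Reasoning
    g′ : Fin n → ℕ
    g′ i = ℕ.pred (g (suc i))
    g-suc : ∀ i → g (suc i) ≡ suc (g′ i)
    g-suc i = sym (ℕP.suc-pred (g (suc i)) {{ℕ.>-nonZero g[suc-i]>0}})
      where
      g[suc-i]>0 : 0 ℕ.< g (suc i)
      g[suc-i]>0 = ℕP.<-≤-trans (s≤s z≤n) (inc (inject₁ i) (suc i) (cong suc (sym (FinP.toℕ-inject₁ i))))
    inc′ : Increasing g′
    inc′ i j j≡i+1 = ℕP.≤-pred (subst₂ ℕ._<_ (g-suc i) (g-suc j) (inc (suc i) (suc j) (cong suc j≡i+1)))
    bnd′ : ∀ i → g′ i ℕ.< n
    bnd′ i = ℕP.≤-pred (subst (ℕ._< suc n) (g-suc i) (bnd (suc i)))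

injective⇒surjective : ∀ {n} {f : Fin n → Fin n} → Injective _≡_ _≡_ f → ∀ y → ∃ λ x → f x ≡ y
injective⇒surjective {n} {f} f-inj y with FinP.any? (λ x → f x FinP.≟ y)
... | yes hit = hit
injective⇒surjective {suc n} {f} f-inj y | no miss =
  contradiction (FinP.injective⇒≤ f-avoiding-y-injective) ℕP.1+n≰n
  where
  f-avoiding-y : Fin (suc n) → Fin n
  f-avoiding-y x = punchOut {i = y} {j = f x} (λ e → miss (x , sym e))
  f-avoiding-y-injective : Injective _≡_ _≡_ f-avoiding-y
  f-avoiding-y-injective {x} {x′} e =
    f-inj (FinP.punchOut-injective (λ e → miss (x , sym e)) (λ e → miss (x′ , sym e)) e)

module Rank {a ℓ₁ ℓ₂} (O : StrictTotalOrder a ℓ₁ ℓ₂) {n : ℕ}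
            (key : Fin n → StrictTotalOrder.Carrier O)
            (key-injective : ∀ {j j′} → StrictTotalOrder._≈_ O (key j) (key j′) → j ≡ j′) where

  open StrictTotalOrder O using (_<_; _<?_; compare; irrefl; module Eq)
    renaming (trans to <-trans)

  below : Fin n → Subset n
  below j = tabulate (λ x → does (key x <? key j))

  ∈below⇒< : ∀ {x j} → x ∈ below j → key x < key j
  ∈below⇒< {x} {j} x∈ with key x <? key j | trans (sym (lookup∘tabulate _ x)) ([]=⇒lookup x∈)
  ... | yes x<j | _  = x<j
  ... | no _    | ()

  <⇒∈below : ∀ {x j} → key x < key j → x ∈ below j
  <⇒∈below {x} {j} x<j =
    lookup⇒[]= x (below j) (trans (lookup∘tabulate _ x) (dec-true (key x <? key j) x<j))

  j∉below-j : ∀ j → j ∉ below j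
  j∉below-j j j∈ = irrefl Eq.refl (∈below⇒< j∈)

  below⊂⊤ : ∀ j → below j ⊂ ⊤
  below⊂⊤ j = ⊆⊤ , j , ∈⊤ , j∉below-j j

  below-mono : ∀ {j j′} → key j < key j′ → below j ⊂ below j′
  below-mono {j} {j′} j<j′ =
    (λ x∈ → <⇒∈below (<-trans (∈below⇒< x∈) j<j′)) , j , <⇒∈below j<j′ , j∉below-j j

  rank : Fin n → Fin n
  rank j = fromℕ< (subst (size (below j) ℕ.<_) (∣⊤∣≡n n) (p⊂q⇒∣p∣<∣q∣ (below⊂⊤ j)))

  toℕ-rank : ∀ j → toℕ (rank j) ≡ size (below j)
  toℕ-rank j = FinP.toℕ-fromℕ< _

  rank-mono : ∀ {j j′} → key j < key j′ → toℕ (rank j) ℕ.< toℕ (rank j′)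
  rank-mono {j} {j′} j<j′ =
    subst₂ ℕ._<_ (sym (toℕ-rank j)) (sym (toℕ-rank j′)) (p⊂q⇒∣p∣<∣q∣ (below-mono j<j′))

  rank-injective : Injective _≡_ _≡_ rank
  rank-injective {j} {j′} e with compare (key j) (key j′)
  ... | tri< j<j′ _ _ = contradiction (cong toℕ e) (ℕP.<⇒≢ (rank-mono j<j′))
  ... | tri≈ _ j≈j′ _ = key-injective j≈j′
  ... | tri> _ _ j>j′ = contradiction (cong toℕ e) (ℕP.>⇒≢ (rank-mono j>j′))

  rank-increasing-enumeration : (e : Fin n → Fin n) →
    (∀ i i′ → toℕ i′ ≡ suc (toℕ i) → key (e i) < key (e i′)) → ∀ i → rank (e i) ≡ i
  rank-increasing-enumeration e inc i = FinP.toℕ-injective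
    (increasing-bounded⇒≡toℕ (toℕ ∘ rank ∘ e) (λ i i′ i′≡i+1 → rank-mono (inc i i′ i′≡i+1))
                              (λ i → FinP.toℕ<n (rank (e i))) i)

  sorted : Fin n → Fin n
  sorted i = proj₁ (injective⇒surjective rank-injective i)

  rank-sorted : ∀ i → rank (sorted i) ≡ i
  rank-sorted i = proj₂ (injective⇒surjective rank-injective i)

  sorted-rank : ∀ j → sorted (rank j) ≡ j
  sorted-rank j = rank-injective (rank-sorted (rank j))

  sorted-injective : Injective _≡_ _≡_ sorted
  sorted-injective {i} {i′} e = trans (sym (rank-sorted i)) (trans (cong rank e) (rank-sorted i′))

  sorted-increasing : ∀ {i i′} → toℕ i ℕ.< toℕ i′ → key (sorted i) < key (sorted i′)
  sorted-increasing {i} {i′} i<i′ with compare (key (sorted i)) (key (sorted i′))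
  ... | tri< lt _ _ = lt
  ... | tri≈ _ eq _ = contradiction (cong toℕ (sorted-injective (key-injective eq))) (ℕP.<⇒≢ i<i′)
  ... | tri> _ _ gt = contradiction
    (subst₂ ℕ._<_ (cong toℕ (rank-sorted i′)) (cong toℕ (rank-sorted i)) (rank-mono gt)) (ℕP.<⇒≯ i<i′)

-- The action of a signed permutation

abs-cases : ∀ {i m} → ∣ i ∣ ≡ m → i ≡ + m ⊎ i ≡ - + m
abs-cases {+ _}      refl = inj₁ refl
abs-cases { -[1+ _ ]} refl = inj₂ refl

basis-on : ∀ n k (j : Fin n) → ∣ k ∣ ≡ suc (toℕ j) → basis n k j ≡ sign k ◃ 1
basis-on n k j ∣k∣≡j+1
  with k ℤ.≟ + suc (toℕ j) | k ℤ.≟ - + suc (toℕ j) | abs-cases ∣k∣≡j+1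
... | yes refl | _         | _            = refl
... | no _     | yes refl  | _            = refl
... | no k≢j+1 | no _      | inj₁ k≡j+1   = contradiction k≡j+1 k≢j+1
... | no _     | no k≢-j-1 | inj₂ k≡-j-1  = contradiction k≡-j-1 k≢-j-1

basis-off : ∀ n k (j : Fin n) → ∣ k ∣ ≢ suc (toℕ j) → basis n k j ≡ + 0
basis-off n k j ∣k∣≢j+1 with k ℤ.≟ + suc (toℕ j) | k ℤ.≟ - + suc (toℕ j)
... | yes refl | _        = contradiction refl ∣k∣≢j+1
... | no _     | yes refl = contradiction refl ∣k∣≢j+1
... | no _     | no _     = refl

sumVec-zero : ∀ m n f (j : Fin n) → (∀ i → f i j ≡ + 0) → sumVec m n f j ≡ + 0
sumVec-zero zero    n f j f≡0 = refl
sumVec-zero (suc m) n f j f≡0 =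
  cong₂ ℤ._+_ (f≡0 zero) (sumVec-zero m n (f ∘ suc) j (f≡0 ∘ suc))

sumVec-single : ∀ m n f (j : Fin n) (i : Fin m) → (∀ i′ → i′ ≢ i → f i′ j ≡ + 0) →
                sumVec m n f j ≡ f i j
sumVec-single (suc m) n f j zero    off =
  trans (cong (λ t → f zero j ℤ.+ t) (sumVec-zero m n (f ∘ suc) j (λ i′ → off (suc i′) (λ ()))))
        (ℤP.+-identityʳ (f zero j))
sumVec-single (suc m) n f j (suc i) off =
  trans (cong (λ t → t ℤ.+ sumVec m n (f ∘ suc) j) (off zero (λ ())))
  (trans (ℤP.+-identityˡ _)
         (sumVec-single m n (f ∘ suc) j i (λ i′ i′≢i → off (suc i′) (i′≢i ∘ FinP.suc-injective))))

+*◃1 : ∀ l s → + l * (s ◃ 1) ≡ s ◃ l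
+*◃1 l s = begin
  + l * (s ◃ 1)           ≡⟨ cong (_* (s ◃ 1)) (sym (ℤP.+◃n≡+n l)) ⟩
  (Sign.+ ◃ l) * (s ◃ 1)  ≡⟨ sym (ℤP.◃-distrib-* Sign.+ s l 1) ⟩
  s ◃ (l ℕ.* 1)           ≡⟨ cong (s ◃_) (ℕP.*-identityʳ l) ⟩
  s ◃ l                   ∎
  where open ≡-Reasoning

act-on : ∀ n u (l : Fin n → ℕ) → (∀ i i′ → ∣ u i ∣ ≡ ∣ u i′ ∣ → i ≡ i′) →
         ∀ i j → ∣ u i ∣ ≡ suc (toℕ j) → act n u (λ i → + l i) j ≡ sign (u i) ◃ l i
act-on n u l u-inj i j ∣ui∣≡j+1 = begin
  act n u (λ i → + l i) j     ≡⟨ sumVec-single n n _ j i off ⟩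
  + l i * basis n (u i) j     ≡⟨ cong (λ t → + l i * t) (basis-on n (u i) j ∣ui∣≡j+1) ⟩
  + l i * (sign (u i) ◃ 1)    ≡⟨ +*◃1 (l i) (sign (u i)) ⟩
  sign (u i) ◃ l i            ∎
  where
  open ≡-Reasoning
  off : ∀ i′ → i′ ≢ i → + l i′ * basis n (u i′) j ≡ + 0
  off i′ i′≢i = trans (cong (λ t → + l i′ * t) (basis-off n (u i′) j ∣ui′∣≢j+1)) (ℤP.*-zeroʳ (+ l i′))
    where
    ∣ui′∣≢j+1 : ∣ u i′ ∣ ≢ suc (toℕ j)
    ∣ui′∣≢j+1 e = i′≢i (u-inj i′ i (trans e (sym ∣ui∣≡j+1)))

-- Lattice paths

eastBefore-mono : ∀ π k → eastBefore π k ≤ eastBefore π (suc k)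
eastBefore-mono []      k       = z≤n
eastBefore-mono (E ∷ π) k       = s≤s (eastBefore-mono π k)
eastBefore-mono (N ∷ π) zero    = z≤n
eastBefore-mono (N ∷ π) (suc k) = eastBefore-mono π k

eastBefore≤countE : ∀ π k → eastBefore π k ≤ countE π
eastBefore≤countE []      k       = z≤n
eastBefore≤countE (E ∷ π) k       = s≤s (eastBefore≤countE π k)
eastBefore≤countE (N ∷ π) zero    = z≤n
eastBefore≤countE (N ∷ π) (suc k) = eastBefore≤countE π k

riseAt-N∷ : ∀ π k → riseAt (N ∷ π) (suc k) ≡ riseAt π k
riseAt-N∷ []      k = refl
riseAt-N∷ (N ∷ π) k = refl
riseAt-N∷ (E ∷ π) k = refl

eastBefore-flat⇒rise : ∀ π k → eastBefore π k ≡ eastBefore π (suc k) → suc k ℕ.< countN π →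
                       riseAt π k ≡ true
eastBefore-flat⇒rise (E ∷ π)     k       flat k+1<c = eastBefore-flat⇒rise π k (ℕP.suc-injective flat) k+1<c
eastBefore-flat⇒rise (N ∷ [])    zero    flat (s≤s ())
eastBefore-flat⇒rise (N ∷ N ∷ π) zero    flat k+1<c = refl
eastBefore-flat⇒rise (N ∷ E ∷ π) zero    ()   k+1<c
eastBefore-flat⇒rise (N ∷ π)     (suc k) flat (s≤s k+1<c) =
  trans (riseAt-N∷ π k) (eastBefore-flat⇒rise π k flat k+1<c)

eastBefore-0⇒startsWithN : ∀ π → eastBefore π 0 ≡ 0 → 0 ℕ.< countN π → startsWithN π ≡ true
eastBefore-0⇒startsWithN (N ∷ π) _ _ = refl

eastBefore-injective : ∀ π π′ {c} → countN π ≡ c → countN π′ ≡ c → countE π ≡ countE π′ →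
                       (∀ (i : Fin c) → eastBefore π (toℕ i) ≡ eastBefore π′ (toℕ i)) → π ≡ π′
eastBefore-injective []      []       _    _    _  _  = refl
eastBefore-injective []      (N ∷ π′) refl ()   _  _
eastBefore-injective []      (E ∷ π′) _    _    () _
eastBefore-injective (N ∷ π) []       refl ()   _  _
eastBefore-injective (E ∷ π) []       _    _    () _
eastBefore-injective (N ∷ π) (N ∷ π′) {suc c} refl c′ e eb =
  cong (N ∷_) (eastBefore-injective π π′ refl (ℕP.suc-injective c′) e (eb ∘ suc))
eastBefore-injective (N ∷ π) (E ∷ π′) {suc c} refl _ _ eb with eb zero
... | ()
eastBefore-injective (E ∷ π) (N ∷ π′) _ refl _ eb with eb zero
... | ()
eastBefore-injective (E ∷ π) (E ∷ π′) c c′ e eb =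
  cong (E ∷_) (eastBefore-injective π π′ c c′ (ℕP.suc-injective e) (ℕP.suc-injective ∘ eb))

prependE : ℕ → List Step → List Step
prependE zero    π = π
prependE (suc a) π = E ∷ prependE a π

eastBefore-prependE : ∀ a π k → eastBefore (prependE a π) k ≡ a ℕ.+ eastBefore π k
eastBefore-prependE zero    π k = refl
eastBefore-prependE (suc a) π k = cong suc (eastBefore-prependE a π k)

riseAt-prependE : ∀ a π k → riseAt (prependE a π) k ≡ riseAt π k
riseAt-prependE zero    π k = refl
riseAt-prependE (suc a) π k = riseAt-prependE a π k

countN-prependE : ∀ a π → countN (prependE a π) ≡ countN π
countN-prependE zero    π = refl
countN-prependE (suc a) π = countN-prependE a π

countE-prependE : ∀ a π → countE (prependE a π) ≡ a ℕ.+ countE π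
countE-prependE zero    π = refl
countE-prependE (suc a) π = cong suc (countE-prependE a π)

-- The path with n East steps whose i-th North step comes after f i of them, prev East steps
-- being already taken before it starts.
path : (n prev : ℕ) {c : ℕ} → (Fin c → ℕ) → List Step
path n prev {zero}  f = prependE (n ℕ.∸ prev) []
path n prev {suc c} f = prependE (f zero ℕ.∸ prev) (N ∷ path n (f zero) (f ∘ suc))

Monotone : ∀ {c} → (Fin c → ℕ) → Set
Monotone f = ∀ {i j} → i Fin.≤ j → f i ≤ f j

m+[[n∸m]+k]≡n+k : ∀ {m n} k → m ≤ n → m ℕ.+ ((n ℕ.∸ m) ℕ.+ k) ≡ n ℕ.+ k
m+[[n∸m]+k]≡n+k {m} {n} k m≤n =
  trans (sym (ℕP.+-assoc m (n ℕ.∸ m) k)) (cong (ℕ._+ k) (ℕP.m+[n∸m]≡n m≤n))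

countN-path : ∀ n prev {c} (f : Fin c → ℕ) → countN (path n prev f) ≡ c
countN-path n prev {zero}  f = countN-prependE (n ℕ.∸ prev) []
countN-path n prev {suc c} f =
  trans (countN-prependE (f zero ℕ.∸ prev) _) (cong suc (countN-path n (f zero) (f ∘ suc)))

countE-path : ∀ n prev {c} (f : Fin c → ℕ) → Monotone f → prev ≤ n →
              (∀ i → prev ≤ f i) → (∀ i → f i ≤ n) → prev ℕ.+ countE (path n prev f) ≡ n
countE-path n prev {zero}  f mono prev≤n lo hi = begin
  prev ℕ.+ countE (prependE (n ℕ.∸ prev) [])  ≡⟨ cong (prev ℕ.+_) (countE-prependE (n ℕ.∸ prev) []) ⟩
  prev ℕ.+ ((n ℕ.∸ prev) ℕ.+ 0)               ≡⟨ m+[[n∸m]+k]≡n+k 0 prev≤n ⟩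
  n ℕ.+ 0                                     ≡⟨ ℕP.+-identityʳ n ⟩
  n                                           ∎
  where open ≡-Reasoning
countE-path n prev {suc c} f mono prev≤n lo hi = begin
  prev ℕ.+ countE (prependE (f zero ℕ.∸ prev) (N ∷ rest))
    ≡⟨ cong (prev ℕ.+_) (countE-prependE (f zero ℕ.∸ prev) _) ⟩
  prev ℕ.+ ((f zero ℕ.∸ prev) ℕ.+ countE rest) ≡⟨ m+[[n∸m]+k]≡n+k (countE rest) (lo zero) ⟩
  f zero ℕ.+ countE rest
    ≡⟨ countE-path n (f zero) (f ∘ suc) (mono ∘ s≤s) (hi zero) (λ _ → mono z≤n) (hi ∘ suc) ⟩
  n ∎
  where
  open ≡-Reasoning
  rest : List Step
  rest = path n (f zero) (f ∘ suc)

eastBefore-path : ∀ n prev {c} (f : Fin c → ℕ) → Monotone f → (∀ i → prev ≤ f i) →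
                  ∀ i → prev ℕ.+ eastBefore (path n prev f) (toℕ i) ≡ f i
eastBefore-path n prev {suc c} f mono lo i = begin
  prev ℕ.+ eastBefore (prependE (f zero ℕ.∸ prev) (N ∷ rest)) (toℕ i)
    ≡⟨ cong (prev ℕ.+_) (eastBefore-prependE (f zero ℕ.∸ prev) _ (toℕ i)) ⟩
  prev ℕ.+ ((f zero ℕ.∸ prev) ℕ.+ eastBefore (N ∷ rest) (toℕ i))
    ≡⟨ m+[[n∸m]+k]≡n+k _ (lo zero) ⟩
  f zero ℕ.+ eastBefore (N ∷ rest) (toℕ i)
    ≡⟨ after-first i ⟩
  f i ∎
  where
  open ≡-Reasoning
  rest : List Step
  rest = path n (f zero) (f ∘ suc)
  after-first : ∀ i → f zero ℕ.+ eastBefore (N ∷ rest) (toℕ i) ≡ f i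
  after-first zero    = ℕP.+-identityʳ (f zero)
  after-first (suc i) = eastBefore-path n (f zero) (f ∘ suc) (mono ∘ s≤s) (λ i → mono z≤n) i

riseAt-path-first : ∀ n {c} (f : Fin (suc c) → ℕ) → Monotone f → ∀ j → toℕ j ≡ 1 →
                    riseAt (N ∷ path n (f zero) (f ∘ suc)) 0 ≡ true → f zero ≡ f j
riseAt-path-first n {suc c} f mono (suc zero) refl rise with f (suc zero) ℕ.∸ f zero in gap
... | zero = ℕP.≤-antisym (mono z≤n) (ℕP.m∸n≡0⇒m≤n gap)
riseAt-path-first n {suc c} f mono (suc zero) refl () | suc _

riseAt-path : ∀ n prev {c} (f : Fin c → ℕ) → Monotone f → ∀ i j → toℕ j ≡ suc (toℕ i) →
              riseAt (path n prev f) (toℕ i) ≡ true → f i ≡ f j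
riseAt-path n prev {suc c} f mono i j j≡i+1 rise =
  after-first i j j≡i+1 (trans (sym (riseAt-prependE (f zero ℕ.∸ prev) _ (toℕ i))) rise)
  where
  after-first : ∀ i j → toℕ j ≡ suc (toℕ i) → riseAt (N ∷ path n (f zero) (f ∘ suc)) (toℕ i) ≡ true →
                f i ≡ f j
  after-first zero    j       j≡1   rise = riseAt-path-first n f mono j j≡1 rise
  after-first (suc i) (suc j) j≡i+2 rise =
    riseAt-path n (f zero) (f ∘ suc) (mono ∘ s≤s) i j (ℕP.suc-injective j≡i+2)
                (trans (sym (riseAt-N∷ (path n (f zero) (f ∘ suc)) (toℕ i))) rise)

startsWithN-path : ∀ n {c} (f : Fin c → ℕ) → startsWithN (path n 0 f) ≡ true →
                   ∀ i → toℕ i ≡ 0 → f i ≡ 0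
startsWithN-path n {suc c} f starts zero refl with f zero
... | zero = refl
startsWithN-path n {suc c} f () zero refl | suc _

-- Decoding a balanced vector

Lex : StrictTotalOrder _ _ _
Lex = ×-strictTotalOrder ℕP.<-strictTotalOrder ℤP.<-strictTotalOrder

open StrictTotalOrder Lex using () renaming (_<_ to _<ₗ_; _≈_ to _≈ₗ_)

signedKey : ∀ {n} → ℤ → Fin n → ℕ × ℤ
signedKey x j = ∣ x ∣ , sign x ◃ suc (toℕ j)

signedKey-injective : ∀ {n} (w : Fin n → ℤ) {j j′} → signedKey (w j) j ≈ₗ signedKey (w j′) j′ → j ≡ j′
signedKey-injective w (_ , e) = FinP.toℕ-injective (ℕP.suc-injective (ℤP.abs-cong e))

signedKey-inverse : ∀ {n} x (j : Fin n) → sign (proj₂ (signedKey x j)) ◃ proj₁ (signedKey x j) ≡ x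
signedKey-inverse x j = trans (cong (_◃ ∣ x ∣) (ℤP.sign-◃ (sign x) (suc (toℕ j)))) (ℤP.◃-inverse x)

sign-◃-sign : ∀ x e → (e ≡ 0 → + 0 ℤ.< x) → sign (sign x ◃ e) ≡ sign x
sign-◃-sign x        (suc e) _ = ℤP.sign-◃ (sign x) (suc e)
sign-◃-sign (+ _)    zero    _ = refl
sign-◃-sign -[1+ _ ] zero    pos with pos refl
... | ()

1≤a≤n⇒a≡1+toℕ : ∀ {n a} → 1 ≤ a → a ≤ n → ∃ λ (j : Fin n) → a ≡ suc (toℕ j)
1≤a≤n⇒a≡1+toℕ {a = suc a} _ a<n = fromℕ< a<n , cong suc (sym (FinP.toℕ-fromℕ< a<n))

module Vertex {n π u} (V : IsVert n π u) where

  countN≡n : countN π ≡ n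
  countN≡n = proj₁ (proj₁ V)

  countE≡n : countE π ≡ n
  countE≡n = proj₂ (proj₁ V)

  private
    signedPerm : IsSignedPerm n u
    signedPerm = proj₁ (proj₂ V)
    rise⇒< : ∀ i j → toℕ j ≡ suc (toℕ i) → riseAt π (toℕ i) ≡ true → u i ℤ.< u j
    rise⇒< = proj₁ (proj₂ (proj₂ V))
    starts⇒first>0 : startsWithN π ≡ true → ∀ i → toℕ i ≡ 0 → + 0 ℤ.< u i
    starts⇒first>0 = proj₂ (proj₂ (proj₂ V))
    slot-exists : ∀ i → ∃ λ (j : Fin n) → ∣ u i ∣ ≡ suc (toℕ j)
    slot-exists i = 1≤a≤n⇒a≡1+toℕ (proj₁ (proj₁ signedPerm i)) (proj₂ (proj₁ signedPerm i))

  east : Fin n → ℕ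
  east i = eastBefore π (toℕ i)

  slot : Fin n → Fin n
  slot i = proj₁ (slot-exists i)

  ∣u∣≡1+slot : ∀ i → ∣ u i ∣ ≡ suc (toℕ (slot i))
  ∣u∣≡1+slot i = proj₂ (slot-exists i)

  slot-injective : Injective _≡_ _≡_ slot
  slot-injective {i} {i′} e =
    proj₂ signedPerm i i′ (trans (∣u∣≡1+slot i) (trans (cong (suc ∘ toℕ) e) (sym (∣u∣≡1+slot i′))))

  ψ-slot : ∀ i → psi n π u (slot i) ≡ sign (u i) ◃ east i
  ψ-slot i = act-on n u east (proj₂ signedPerm) i (slot i) (∣u∣≡1+slot i)

  ψ-bounded : ∀ j → ∣ psi n π u j ∣ ≤ n
  ψ-bounded j with injective⇒surjective slot-injective j
  ... | i , refl = begin
    ∣ psi n π u (slot i) ∣   ≡⟨ cong ∣_∣ (ψ-slot i) ⟩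
    ∣ sign (u i) ◃ east i ∣  ≡⟨ ℤP.abs-◃ (sign (u i)) (east i) ⟩
    east i                   ≤⟨ eastBefore≤countE π (toℕ i) ⟩
    countE π                 ≡⟨ countE≡n ⟩
    n                        ∎
    where open ℕP.≤-Reasoning

  -- If east i = 0, then π begins with its North steps 0, …, i, so the start condition and the
  -- rises between them give 0 < u 0 < ⋯ < u i.
  east≡0⇒u>0 : ∀ k (i : Fin n) → toℕ i ≡ k → east i ≡ 0 → + 0 ℤ.< u i
  east≡0⇒u>0 zero    i i≡0 eb≡0 =
    starts⇒first>0 (eastBefore-0⇒startsWithN π (subst (λ k → eastBefore π k ≡ 0) i≡0 eb≡0) 0<countN)
                   i i≡0
    where
    0<countN : 0 ℕ.< countN π
    0<countN = subst (0 ℕ.<_) (sym countN≡n) (ℕP.≤-<-trans z≤n (subst (ℕ._< n) i≡0 (FinP.toℕ<n i)))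
  east≡0⇒u>0 (suc k) i i≡k+1 eb≡0 =
    ℤP.<-trans (east≡0⇒u>0 k p p≡k (subst (λ t → eastBefore π t ≡ 0) (sym p≡k) eb[k]≡0))
               (rise⇒< p i (trans i≡k+1 (cong suc (sym p≡k))) rise)
    where
    k+1<n : suc k ℕ.< n
    k+1<n = subst (ℕ._< n) i≡k+1 (FinP.toℕ<n i)
    p : Fin n
    p = fromℕ< (ℕP.<-trans (ℕP.n<1+n k) k+1<n)
    p≡k : toℕ p ≡ k
    p≡k = FinP.toℕ-fromℕ< _
    eb[k+1]≡0 : eastBefore π (suc k) ≡ 0
    eb[k+1]≡0 = subst (λ t → eastBefore π t ≡ 0) i≡k+1 eb≡0
    eb[k]≡0 : eastBefore π k ≡ 0
    eb[k]≡0 = ℕP.n≤0⇒n≡0 (subst (eastBefore π k ≤_) eb[k+1]≡0 (eastBefore-mono π k))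
    rise : riseAt π (toℕ p) ≡ true
    rise = subst (λ t → riseAt π t ≡ true) (sym p≡k)
      (eastBefore-flat⇒rise π k (trans eb[k]≡0 (sym eb[k+1]≡0))
                                (subst (suc k ℕ.<_) (sym countN≡n) k+1<n))

  signedKey-ψ-slot : ∀ i → signedKey (psi n π u (slot i)) (slot i) ≡ (east i , u i)
  signedKey-ψ-slot i rewrite ψ-slot i =
    cong₂ _,_ (ℤP.abs-◃ (sign (u i)) (east i)) (ℤP.◃-cong sign≡ abs≡)
    where
    sign≡ : sign (sign (sign (u i) ◃ east i) ◃ suc (toℕ (slot i))) ≡ sign (u i)
    sign≡ = trans (ℤP.sign-◃ _ (suc (toℕ (slot i))))
                  (sign-◃-sign (u i) (east i) (east≡0⇒u>0 (toℕ i) i refl))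
    abs≡ : ∣ sign (sign (u i) ◃ east i) ◃ suc (toℕ (slot i)) ∣ ≡ ∣ u i ∣
    abs≡ = trans (ℤP.abs-◃ (sign (sign (u i) ◃ east i)) _) (sym (∣u∣≡1+slot i))

  increasing : ∀ i j → toℕ j ≡ suc (toℕ i) → (east i , u i) <ₗ (east j , u j)
  increasing i j j≡i+1
    with ℕP.m≤n⇒m<n∨m≡n (subst (λ k → east i ≤ eastBefore π k) (sym j≡i+1) (eastBefore-mono π (toℕ i)))
  ... | inj₁ east-i<east-j = inj₁ east-i<east-j
  ... | inj₂ east-i≡east-j = inj₂ (east-i≡east-j , rise⇒< i j j≡i+1 rise)
    where
    rise : riseAt π (toℕ i) ≡ true
    rise = eastBefore-flat⇒rise π (toℕ i) (trans east-i≡east-j (cong (eastBefore π) j≡i+1))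
             (subst (ℕ._< countN π) j≡i+1 (subst (toℕ j ℕ.<_) (sym countN≡n) (FinP.toℕ<n j)))

ψ-injective : ∀ {n π π′ u u′} → IsVert n π u → IsVert n π′ u′ →
              psi n π u ≡[mod suc (n ℕ.+ n) ] psi n π′ u′ → (π ≡ π′) × (∀ i → u i ≡ u′ i)
ψ-injective {n} {π} {π′} {u} {u′} V V′ ψ≡ψ′ = π≡π′ , λ i → cong proj₂ (same-code i)
  where
  module A = Vertex V
  module B = Vertex V′
  w : Fin n → ℤ
  w = psi n π u
  ψ′≡w : ∀ j → psi n π′ u′ j ≡ w j
  ψ′≡w j = sym (balanced-residue-unique n (A.ψ-bounded j) (B.ψ-bounded j) (ψ≡ψ′ j))

  key : Fin n → ℕ × ℤ
  key j = signedKey (w j) j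
  open Rank Lex key (signedKey-injective w)

  key-A : ∀ i → key (A.slot i) ≡ (A.east i , u i)
  key-A = A.signedKey-ψ-slot
  key-B : ∀ i → key (B.slot i) ≡ (B.east i , u′ i)
  key-B i = trans (cong (λ x → signedKey x (B.slot i)) (sym (ψ′≡w (B.slot i))))
                  (B.signedKey-ψ-slot i)

  rank-A : ∀ i → rank (A.slot i) ≡ i
  rank-A = rank-increasing-enumeration A.slot
    (λ i j j≡i+1 → subst₂ _<ₗ_ (sym (key-A i)) (sym (key-A j)) (A.increasing i j j≡i+1))
  rank-B : ∀ i → rank (B.slot i) ≡ i
  rank-B = rank-increasing-enumeration B.slot
    (λ i j j≡i+1 → subst₂ _<ₗ_ (sym (key-B i)) (sym (key-B j)) (B.increasing i j j≡i+1))

  same-slot : ∀ i → A.slot i ≡ B.slot i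
  same-slot i = rank-injective (trans (rank-A i) (sym (rank-B i)))

  same-code : ∀ i → (A.east i , u i) ≡ (B.east i , u′ i)
  same-code i = trans (sym (key-A i)) (trans (cong key (same-slot i)) (key-B i))

  π≡π′ : π ≡ π′
  π≡π′ = eastBefore-injective π π′ A.countN≡n B.countN≡n (trans A.countE≡n (sym B.countE≡n))
                              (cong proj₁ ∘ same-code)

module Preimage {n} (r : Fin n → ℤ) (r-bounded : ∀ j → ∣ r j ∣ ≤ n) where

  key : Fin n → ℕ × ℤ
  key j = signedKey (r j) j
  open Rank Lex key (signedKey-injective r)

  east : Fin n → ℕ
  east i = proj₁ (key (sorted i))

  u : Fin n → ℤ
  u i = proj₂ (key (sorted i))

  π : List Step
  π = path n 0 east

  east-monotone : Monotone east
  east-monotone {i} {j} i≤j with ℕP.m≤n⇒m<n∨m≡n i≤j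
  ... | inj₁ i<j       = first-≤ (sorted-increasing i<j)
    where
    first-≤ : ∀ {a b s t} → (a , s) <ₗ (b , t) → a ≤ b
    first-≤ (inj₁ a<b)       = ℕP.<⇒≤ a<b
    first-≤ (inj₂ (a≡b , _)) = ℕP.≤-reflexive a≡b
  ... | inj₂ toℕi≡toℕj = ℕP.≤-reflexive (cong east (FinP.toℕ-injective toℕi≡toℕj))

  eastBefore-π : ∀ i → eastBefore π (toℕ i) ≡ east i
  eastBefore-π = eastBefore-path n 0 east east-monotone (λ _ → z≤n)

  ∣u∣≡1+sorted : ∀ i → ∣ u i ∣ ≡ suc (toℕ (sorted i))
  ∣u∣≡1+sorted i = ℤP.abs-◃ (sign (r (sorted i))) _

  ∣u∣-injective : ∀ i i′ → ∣ u i ∣ ≡ ∣ u i′ ∣ → i ≡ i′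
  ∣u∣-injective i i′ e = sorted-injective (FinP.toℕ-injective (ℕP.suc-injective
    (trans (sym (∣u∣≡1+sorted i)) (trans e (∣u∣≡1+sorted i′)))))

  isVert : IsVert n π u
  isVert = (countN-path n 0 east , countE-path n 0 east east-monotone z≤n (λ _ → z≤n) (r-bounded ∘ sorted))
         , (∣u∣-bounds , ∣u∣-injective)
         , rise⇒<
         , starts⇒first>0
    where
    ∣u∣-bounds : ∀ i → 1 ≤ ∣ u i ∣ × ∣ u i ∣ ≤ n
    ∣u∣-bounds i rewrite ∣u∣≡1+sorted i = s≤s z≤n , FinP.toℕ<n (sorted i)
    rise⇒< : ∀ i j → toℕ j ≡ suc (toℕ i) → riseAt π (toℕ i) ≡ true → u i ℤ.< u j
    rise⇒< i j j≡i+1 rise with sorted-increasing (subst (toℕ i ℕ.<_) (sym j≡i+1) (ℕP.n<1+n (toℕ i)))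
    ... | inj₁ east-i<east-j  =
      contradiction (riseAt-path n 0 east east-monotone i j j≡i+1 rise) (ℕP.<⇒≢ east-i<east-j)
    ... | inj₂ (_ , u-i<u-j) = u-i<u-j
    starts⇒first>0 : startsWithN π ≡ true → ∀ i → toℕ i ≡ 0 → + 0 ℤ.< u i
    starts⇒first>0 starts i i≡0 =
      positive (r (sorted i)) (toℕ (sorted i)) (startsWithN-path n east starts i i≡0)
      where
      positive : ∀ x k → ∣ x ∣ ≡ 0 → + 0 ℤ.< sign x ◃ suc k
      positive (+ zero) k _ = ℤ.+<+ (s≤s z≤n)

  ψ≡r : ∀ j → psi n π u j ≡ r j
  ψ≡r j = begin
    psi n π u j                            ≡⟨ act-on n u (λ i → eastBefore π (toℕ i)) ∣u∣-injective i j ∣u-i∣≡1+j ⟩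
    sign (u i) ◃ eastBefore π (toℕ i)      ≡⟨ cong (sign (u i) ◃_) (eastBefore-π i) ⟩
    sign (u i) ◃ east i                    ≡⟨ cong (λ j → sign (proj₂ (key j)) ◃ proj₁ (key j)) (sorted-rank j) ⟩
    sign (proj₂ (key j)) ◃ proj₁ (key j)   ≡⟨ signedKey-inverse (r j) j ⟩
    r j                                    ∎
    where
    open ≡-Reasoning
    i : Fin n
    i = rank j
    ∣u-i∣≡1+j : ∣ u i ∣ ≡ suc (toℕ j)
    ∣u-i∣≡1+j = trans (∣u∣≡1+sorted i) (cong (suc ∘ toℕ) (sorted-rank j))

ψ-surjective : ∀ {n} (v : Fin n → ℤ) → Σ (List Step) λ π → Σ (Fin n → ℤ) λ u →
               IsVert n π u × (psi n π u ≡[mod suc (n ℕ.+ n) ] v)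
ψ-surjective {n} v = π , u , isVert , λ j → subst (λ x → M ∣ (x - v j)) (sym (ψ≡r j)) (proj₂ (proj₂ (residue j)))
  where
  M : ℤ
  M = + suc (n ℕ.+ n)
  residue : ∀ j → Σ ℤ λ r → ∣ r ∣ ≤ n × M ∣ (r - v j)
  residue j = balanced-residue n (v j)
  open Preimage (proj₁ ∘ residue) (proj₁ ∘ proj₂ ∘ residue)

proposition4p2 : ∀ (n : ℕ) → 1 ≤ n →
    (∀ (π π' : List Step) (u u' : Fin n → ℤ) →
      IsVert n π u → IsVert n π' u' →
      psi n π u ≡[mod suc (n ℕ.+ n) ] psi n π' u' →
      (π ≡ π') × (∀ i → u i ≡ u' i))
    ×
    (∀ (v : Fin n → ℤ) → Σ (List Step) λ π → Σ (Fin n → ℤ) λ u →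
      IsVert n π u × (psi n π u ≡[mod suc (n ℕ.+ n) ] v))
proposition4p2 n _ = (λ _ _ _ _ → ψ-injective) , ψ-surjective
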